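{- Let $n\ge2$ and let $\mathsf u$ be an $e$-subword of $\boldsymbol\lambda_n$. Extend the indices of $\mathsf u$ periodically, $u_{i}=u_{i+n(n-1)}$ for all $i\in\mathbb Z$. Then for all integers $k$ and all integers $a,b$ with $0\le b-a<n(n-1)$, \[\big|(u_a u_{a+1}\cdots u_b)(k)-k\big|\le n-2.\]
   Context: $\widetilde S_n$ is the affine symmetric group (bijections $w:\mathbb Z\to\mathbb Z$ with $w(i+n)=w(i)+n$ and $\sum_{i=1}^n w(i)=\binom{n+1}{2}$, multiplied by composition $(vw)(k)=v(w(k))$). $s_j$ interchanges $j+kn$ and $j+1+kn$ for all $k$ (index mod $n$). $\boldsymbol\lambda_n$ is the word $[s_0,\dots,s_{n-1}]$ repeated $n-1$ times; its $j$-th letter ($1\le j\le n(n-1)$) is $s_{j-1}$. A subword is $\mathsf u=[u_1,\dots,u_{n(n-1)}]$ with each $u_j$ equal to either the $j$-th letter or the identity $e$; it is an $e$-subword if $u_1\cdots u_{n(n-1)}=e$. -}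

module Defs where

open import Data.Bool using (Bool; true; false; if_then_else_)
open import Data.Nat as ℕ using (ℕ; zero; suc; _≤_; _<_; _∸_; s≤s; z≤n; NonZero)
open import Data.Fin using (Fin; fromℕ<)
open import Data.Integer as ℤ using (ℤ; +_; _-_)
open import Data.Integer.DivMod using (_%ℕ_; n%ℕd<d)
open import Relation.Nullary using (does)

-- Length n(n-1) of the word λ_n = [s_0,…,s_{n-1}] repeated n-1 times.
len : ℕ → ℕ
len n = n ℕ.* (n ∸ 1)

len-nonZero : ∀ n → 2 ≤ n → NonZero (len n)
len-nonZero (suc (suc m)) (s≤s (s≤s _)) = _

n-nonZero : ∀ n → 2 ≤ n → NonZero n
n-nonZero (suc (suc m)) (s≤s (s≤s _)) = _

-- The simple reflection s_j of the affine symmetric group \tilde S_n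
-- (j taken mod n), as a bijection ℤ → ℤ: it interchanges j + kn and
-- j + 1 + kn for all k.
s' : (n : ℕ) → .{{NonZero n}} → ℕ → ℤ → ℤ
s' n j x =
  let r  = x %ℕ n
      j₀ = j ℕ.% n
      j₁ = suc j ℕ.% n
  in if does (r ℕ.≟ j₀) then x ℤ.+ + 1
     else if does (r ℕ.≟ j₁) then x - + 1
     else x

s : (n : ℕ) → 2 ≤ n → ℕ → ℤ → ℤ
s n h = s' n {{n-nonZero n h}}

-- A subword of λ_n: for each position j (1 ≤ j ≤ n(n-1), stored 0-based
-- as Fin (len n)), true means u_j is the j-th letter, false means u_j = e.
Subword : ℕ → Set
Subword n = Fin (len n) → Bool

-- Position j (1-based) of λ_n is
-- the letter s_{j-1}, indices mod n.
u' : (n : ℕ) → 2 ≤ n → .{{NonZero (len n)}} → Subword n → ℤ → ℤ → ℤ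
u' n h c j with c (fromℕ< (n%ℕd<d (j - + 1) (len n)))
... | true  = s n h ((j - + 1) %ℕ len n)
... | false = λ x → x

u : (n : ℕ) → 2 ≤ n → Subword n → ℤ → ℤ → ℤ
u n h = u' n h {{len-nonZero n h}}

-- (u_a u_{a+1} ⋯ u_{a+d})(k), products acting by composition,
-- i.e. u_a(u_{a+1}(⋯ u_{a+d}(k))).
uProd : (n : ℕ) → 2 ≤ n → Subword n → ℤ → ℕ → ℤ → ℤ
uProd n h c a zero    k = u n h c a k
uProd n h c a (suc d) k = uProd n h c a d (u n h c (a ℤ.+ + suc d) k)

IsESubword : (n : ℕ) → 2 ≤ n → Subword n → Set
IsESubword n h c = ∀ k → uProd n h c (+ 1) (len n ∸ 1) k ≡ k
  where open import Relation.Binary.PropositionalEquality using (_≡_)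

{-# OPTIONS --safe #-}
module Submission where

-- Write n = m + 2 and L = n(n − 1).  Follow a value x through the letters
-- u_j, u_{j−1}, … of a product and record the residue of x − j mod n.  A letter can raise x
-- only when this residue is n − 1 and lower it only when it is 0, so x − j grows by 2, 0 or 1
-- per letter and the residue runs through the automaton Walk.  Since the letters are
-- involutions and the word is L-periodic, an e-subword makes every product of L consecutive
-- letters trivial, so every partial product extends to a closed walk of length L.  Such a walk
-- passes n − 1 times from residue n − 1 to residue 0 (its laps) and has as many ups as downs.
-- If every lap were an up, the residue could never enter 0, so a down would force the walk to
-- start, hence end, at residue 0 and then never leave it: no ups at all.  Hence there are at
-- most n − 2 ups and n − 2 downs, which bounds the displacement of every partial product.

open import Defs
open import Data.Nat using (ℕ; _≤_; _<_; _∸_)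
open import Data.Integer using (ℤ; +_; _+_; _-_; ∣_∣)

open import Data.Nat as ℕ using (zero; suc; s≤s; z≤n; NonZero)
import Data.Nat.Properties as ℕ
open import Data.Nat.DivMod using (_%_; m%n<n; m<n⇒m%n≡m; n%n≡0; %-distribˡ-+)
open import Data.Nat.Divisibility using (_∣_; divides; n∣m⇒m%n≡0)
import Data.Nat.Tactic.RingSolver as ℕ
open import Data.Integer using (-[1+_]; _*_; -_; _⊖_)
open import Data.Integer.Properties
  using (+-injective; +-identityʳ; +-inverseʳ; +-comm; +-assoc; pos-*; abs-*;
         ∣m⊝n∣≤m⊔n; m-n≡m⊖n; i-j≡0⇒i≡j; ∣i∣≡0⇒i≡0)
open import Data.Integer.DivMod using (_%ℕ_; _/ℕ_; n%ℕd<d; a≡a%ℕn+[a/ℕn]*n)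
import Data.Integer.Tactic.RingSolver as ℤ
open import Data.List using (_∷_; [])
open import Data.Bool using (true; false)
open import Data.Fin using (fromℕ<)
open import Data.Fin.Properties using (fromℕ<-cong)
open import Data.Sum using (_⊎_; inj₁; inj₂)
open import Data.Product using (_×_; _,_; proj₁; proj₂)
open import Data.Empty using (⊥-elim)
open import Relation.Binary.PropositionalEquality
open import Relation.Nullary using (yes; no)
open import Relation.Nullary.Decidable using (dec-true; dec-false)

private
  a+p*N≡b+q*N⇒a-b≡[q-p]*N : ∀ a b p q N → a + p * N ≡ b + q * N → a - b ≡ (q - p) * N
  a+p*N≡b+q*N⇒a-b≡[q-p]*N a b p q N eq = begin
    a - b                   ≡⟨ ℤ.solve (a ∷ b ∷ p ∷ N ∷ []) ⟩
    (a + p * N) - b - p * N ≡⟨ cong (λ t → t - b - p * N) eq ⟩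
    (b + q * N) - b - p * N ≡⟨ ℤ.solve (b ∷ q ∷ p ∷ N ∷ []) ⟩
    (q - p) * N             ∎
    where open ≡-Reasoning

module _ {n : ℕ} .{{_ : NonZero n}} where

  residue-unique : ∀ {r s} p q → r < n → s < n → + r + p * + n ≡ + s + q * + n → r ≡ s
  residue-unique {r} {s} p q r<n s<n eq =
    +-injective (i-j≡0⇒i≡j (+ r) (+ s) (∣i∣≡0⇒i≡0 ∣r-s∣≡0))
    where
    ∣r-s∣<n : ∣ + r - + s ∣ < n
    ∣r-s∣<n = begin-strict
      ∣ + r - + s ∣   ≡⟨ cong ∣_∣ (m-n≡m⊖n r s) ⟩
      ∣ r ⊖ s ∣       ≤⟨ ∣m⊝n∣≤m⊔n r s ⟩
      r ℕ.⊔ s         <⟨ ℕ.⊔-lub r<n s<n ⟩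
      n               ∎
      where open ℕ.≤-Reasoning
    n∣∣r-s∣ : n ∣ ∣ + r - + s ∣
    n∣∣r-s∣ = divides ∣ q - p ∣
      (trans (cong ∣_∣ (a+p*N≡b+q*N⇒a-b≡[q-p]*N (+ r) (+ s) p q (+ n) eq)) (abs-* (q - p) (+ n)))
    ∣r-s∣≡0 : ∣ + r - + s ∣ ≡ 0
    ∣r-s∣≡0 = trans (sym (m<n⇒m%n≡m ∣r-s∣<n)) (n∣m⇒m%n≡0 _ n n∣∣r-s∣)

  a≡r+q*n⇒a%ℕn≡r : ∀ {a r} q → r < n → a ≡ + r + q * + n → a %ℕ n ≡ r
  a≡r+q*n⇒a%ℕn≡r {a} q r<n eq =
    residue-unique (a /ℕ n) q (n%ℕd<d a n) r<n (trans (sym (a≡a%ℕn+[a/ℕn]*n a n)) eq)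

  [a+q*n]%ℕn≡a%ℕn : ∀ a q → (a + q * + n) %ℕ n ≡ a %ℕ n
  [a+q*n]%ℕn≡a%ℕn a q = a≡r+q*n⇒a%ℕn≡r (a /ℕ n + q) (n%ℕd<d a n) (begin
    a + q * + n                                  ≡⟨ cong (_+ q * + n) (a≡a%ℕn+[a/ℕn]*n a n) ⟩
    + (a %ℕ n) + (a /ℕ n) * + n + q * + n        ≡⟨ collect (+ (a %ℕ n)) (a /ℕ n) q (+ n) ⟩
    + (a %ℕ n) + (a /ℕ n + q) * + n              ∎)
    where
    open ≡-Reasoning
    collect : ∀ r p q N → r + p * N + q * N ≡ r + (p + q) * N
    collect = ℤ.solve-∀

  [a+c]%ℕn≡[a%ℕn+c]%ℕn : ∀ a c → (a + c) %ℕ n ≡ (+ (a %ℕ n) + c) %ℕ n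
  [a+c]%ℕn≡[a%ℕn+c]%ℕn a c = begin
    (a + c) %ℕ n                                 ≡⟨ cong (λ t → (t + c) %ℕ n) (a≡a%ℕn+[a/ℕn]*n a n) ⟩
    (+ (a %ℕ n) + (a /ℕ n) * + n + c) %ℕ n       ≡⟨ cong (_%ℕ n) (swap (+ (a %ℕ n)) ((a /ℕ n) * + n) c) ⟩
    (+ (a %ℕ n) + c + (a /ℕ n) * + n) %ℕ n       ≡⟨ [a+q*n]%ℕn≡a%ℕn (+ (a %ℕ n) + c) (a /ℕ n) ⟩
    (+ (a %ℕ n) + c) %ℕ n                        ∎
    where
    open ≡-Reasoning
    swap : ∀ x y z → x + y + z ≡ x + z + y
    swap = ℤ.solve-∀

  %ℕ-+-cong : ∀ a b c → a %ℕ n ≡ b %ℕ n → (a + c) %ℕ n ≡ (b + c) %ℕ n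
  %ℕ-+-cong a b c eq = begin
    (a + c) %ℕ n                ≡⟨ [a+c]%ℕn≡[a%ℕn+c]%ℕn a c ⟩
    (+ (a %ℕ n) + c) %ℕ n       ≡⟨ cong (λ r → (+ r + c) %ℕ n) eq ⟩
    (+ (b %ℕ n) + c) %ℕ n       ≡⟨ [a+c]%ℕn≡[a%ℕn+c]%ℕn b c ⟨
    (b + c) %ℕ n                ∎
    where open ≡-Reasoning

  [a+1]%ℕn≡[1+a%ℕn]%n : ∀ a → (a + + 1) %ℕ n ≡ suc (a %ℕ n) % n
  [a+1]%ℕn≡[1+a%ℕn]%n a = trans ([a+c]%ℕn≡[a%ℕn+c]%ℕn a (+ 1)) (cong (_% n) (ℕ.+-comm (a %ℕ n) 1))

  a%ℕ[n*k]%n≡a%ℕn : ∀ a k .{{_ : NonZero (n ℕ.* k)}} → a %ℕ (n ℕ.* k) % n ≡ a %ℕ n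
  a%ℕ[n*k]%n≡a%ℕn a k = sym (begin
    a %ℕ n                                           ≡⟨ cong (_%ℕ n) (a≡a%ℕn+[a/ℕn]*n a (n ℕ.* k)) ⟩
    (+ r + q * + (n ℕ.* k)) %ℕ n                     ≡⟨ cong (λ t → (+ r + q * t) %ℕ n) (pos-* n k) ⟩
    (+ r + q * (+ n * + k)) %ℕ n                     ≡⟨ cong (_%ℕ n) (regroup (+ r) q (+ n) (+ k)) ⟩
    (+ r + (q * + k) * + n) %ℕ n                     ≡⟨ [a+q*n]%ℕn≡a%ℕn (+ r) (q * + k) ⟩
    r % n                                            ∎)
    where
    open ≡-Reasoning
    r = a %ℕ (n ℕ.* k)
    q = a /ℕ (n ℕ.* k)
    regroup : ∀ x y z w → x + y * (z * w) ≡ x + (y * w) * z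
    regroup = ℤ.solve-∀

module Walks (m : ℕ) where

  n : ℕ
  n = 2 ℕ.+ m

  infixr 5 _++_

  -- Walk r x r′ y ℓ: ℓ letters move the value x, at residue r, to y, at residue r′.  The up
  -- and down steps move x; wrap and tick fix it, wrap being the one that passes n − 1 → 0.
  data Walk : ℕ → ℤ → ℕ → ℤ → ℕ → Set where
    []   : ∀ {r x} → Walk r x r x 0
    up   : ∀ {x r′ y ℓ} → Walk 1 (x + + 1) r′ y ℓ → Walk (suc m) x r′ y (suc ℓ)
    down : ∀ {x r′ y ℓ} → Walk 0 (x - + 1) r′ y ℓ → Walk 0 x r′ y (suc ℓ)
    wrap : ∀ {x r′ y ℓ} → Walk 0 x r′ y ℓ → Walk (suc m) x r′ y (suc ℓ)
    tick : ∀ {r x r′ y ℓ} → r ≢ suc m → Walk (suc r) x r′ y ℓ → Walk r x r′ y (suc ℓ)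

  private variable
    r r′ r″ ℓ ℓ′ : ℕ
    x y z : ℤ

  ups downs laps : Walk r x r′ y ℓ → ℕ
  ups []         = 0
  ups (up p)     = suc (ups p)
  ups (down p)   = ups p
  ups (wrap p)   = ups p
  ups (tick _ p) = ups p

  downs []         = 0
  downs (up p)     = downs p
  downs (down p)   = suc (downs p)
  downs (wrap p)   = downs p
  downs (tick _ p) = downs p

  laps []         = 0
  laps (up p)     = suc (laps p)
  laps (down p)   = laps p
  laps (wrap p)   = suc (laps p)
  laps (tick _ p) = laps p

  _++_ : Walk r x r′ y ℓ → Walk r′ y r″ z ℓ′ → Walk r x r″ z (ℓ ℕ.+ ℓ′)
  []       ++ q = q
  up p     ++ q = up (p ++ q)
  down p   ++ q = down (p ++ q)
  wrap p   ++ q = wrap (p ++ q)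
  tick d p ++ q = tick d (p ++ q)

  ups-++ : (p : Walk r x r′ y ℓ) (q : Walk r′ y r″ z ℓ′) → ups (p ++ q) ≡ ups p ℕ.+ ups q
  ups-++ []         q = refl
  ups-++ (up p)     q = cong suc (ups-++ p q)
  ups-++ (down p)   q = ups-++ p q
  ups-++ (wrap p)   q = ups-++ p q
  ups-++ (tick _ p) q = ups-++ p q

  downs-++ : (p : Walk r x r′ y ℓ) (q : Walk r′ y r″ z ℓ′) → downs (p ++ q) ≡ downs p ℕ.+ downs q
  downs-++ []         q = refl
  downs-++ (up p)     q = downs-++ p q
  downs-++ (down p)   q = cong suc (downs-++ p q)
  downs-++ (wrap p)   q = downs-++ p q
  downs-++ (tick _ p) q = downs-++ p q

  ups≤laps : (p : Walk r x r′ y ℓ) → ups p ≤ laps p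
  ups≤laps []         = z≤n
  ups≤laps (up p)     = s≤s (ups≤laps p)
  ups≤laps (down p)   = ups≤laps p
  ups≤laps (wrap p)   = ℕ.m≤n⇒m≤1+n (ups≤laps p)
  ups≤laps (tick _ p) = ups≤laps p

  displacement : (p : Walk r x r′ y ℓ) → y - x ≡ + ups p - + downs p
  displacement {x = x} []  = +-inverseʳ x
  displacement {x = x} {y = y} (up p) = begin
    y - x                          ≡⟨ ℤ.solve (y ∷ x ∷ []) ⟩
    y - (x + + 1) + + 1            ≡⟨ cong (_+ + 1) (displacement p) ⟩
    + ups p - + downs p + + 1      ≡⟨ [a-b]+1≡[1+a]-b (+ ups p) (+ downs p) ⟩
    + suc (ups p) - + downs p      ∎
    where
    open ≡-Reasoning
    [a-b]+1≡[1+a]-b : ∀ a b → a - b + + 1 ≡ (+ 1 + a) - b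
    [a-b]+1≡[1+a]-b = ℤ.solve-∀
  displacement {x = x} {y = y} (down p) = begin
    y - x                          ≡⟨ ℤ.solve (y ∷ x ∷ []) ⟩
    y - (x - + 1) - + 1            ≡⟨ cong (_- + 1) (displacement p) ⟩
    + ups p - + downs p - + 1      ≡⟨ [a-b]-1≡a-[1+b] (+ ups p) (+ downs p) ⟩
    + ups p - + suc (downs p)      ∎
    where
    open ≡-Reasoning
    [a-b]-1≡a-[1+b] : ∀ a b → a - b - + 1 ≡ a - (+ 1 + b)
    [a-b]-1≡a-[1+b] = ℤ.solve-∀
  displacement (wrap p)   = displacement p
  displacement (tick _ p) = displacement p

  private
    lap-balance : ∀ {a b} d K r′ → b ≡ a ℕ.+ n → a ≡ d ℕ.+ K ℕ.* n ℕ.+ r′ →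
                  b ≡ d ℕ.+ suc K ℕ.* n ℕ.+ r′
    lap-balance d K r′ b≡a+n a≡ = trans b≡a+n (trans (cong (ℕ._+ n) a≡) (regroup d K r′ n))
      where
      regroup : ∀ d K r′ N → d ℕ.+ K ℕ.* N ℕ.+ r′ ℕ.+ N ≡ d ℕ.+ (N ℕ.+ K ℕ.* N) ℕ.+ r′
      regroup = ℕ.solve-∀

  -- Along a walk x − j grows by ℓ + ups − downs, passing laps multiples of n.
  residue-balance : (p : Walk r x r′ y ℓ) → ℓ ℕ.+ ups p ℕ.+ r ≡ downs p ℕ.+ laps p ℕ.* n ℕ.+ r′
  residue-balance []         = refl
  residue-balance {ℓ = suc ℓ} (up p) =
    lap-balance (downs p) (laps p) _ (regroup ℓ (ups p) m) (residue-balance p)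
    where
    regroup : ∀ ℓ u m → suc ℓ ℕ.+ suc u ℕ.+ suc m ≡ ℓ ℕ.+ u ℕ.+ 1 ℕ.+ suc (suc m)
    regroup = ℕ.solve-∀
  residue-balance (down p)   = cong suc (residue-balance p)
  residue-balance {ℓ = suc ℓ} (wrap p) =
    lap-balance (downs p) (laps p) _ (regroup ℓ (ups p) m) (residue-balance p)
    where
    regroup : ∀ ℓ u m → suc ℓ ℕ.+ u ℕ.+ suc m ≡ ℓ ℕ.+ u ℕ.+ 0 ℕ.+ suc (suc m)
    regroup = ℕ.solve-∀
  residue-balance (tick _ p) = trans (sym (ℕ.+-suc _ _)) (residue-balance p)

  private
    ups≢1+laps : (p : Walk r x r′ y ℓ) → ups p ≢ suc (laps p)
    ups≢1+laps p eq = ℕ.<-irrefl refl (subst (_≤ laps p) eq (ups≤laps p))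

  lap-free-walk-into-0 : (p : Walk r x 0 y ℓ) → ups p ≡ laps p → r ≡ 0 × ups p ≡ 0
  lap-free-walk-into-0 []         _  = refl , refl
  lap-free-walk-into-0 (up p)     eq with () ← proj₁ (lap-free-walk-into-0 p (ℕ.suc-injective eq))
  lap-free-walk-into-0 (down p)   eq = refl , proj₂ (lap-free-walk-into-0 p eq)
  lap-free-walk-into-0 (wrap p)   eq = ⊥-elim (ups≢1+laps p eq)
  lap-free-walk-into-0 (tick _ p) eq with () ← proj₁ (lap-free-walk-into-0 p eq)

  lap-free-walk-with-down : (p : Walk r x r′ y ℓ) → ups p ≡ laps p → 0 < downs p → r ≡ 0
  lap-free-walk-with-down []         _  ()
  lap-free-walk-with-down (up p)     eq d>0 with () ← lap-free-walk-with-down p (ℕ.suc-injective eq) d>0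
  lap-free-walk-with-down (down p)   _  _   = refl
  lap-free-walk-with-down (wrap p)   eq _   = ⊥-elim (ups≢1+laps p eq)
  lap-free-walk-with-down (tick _ p) eq d>0 with () ← lap-free-walk-with-down p eq d>0

  lap-free-closed-walk : (p : Walk r x r y ℓ) → ups p ≡ laps p → 0 < downs p → ups p ≡ 0
  lap-free-closed-walk p eq d>0 with refl ← lap-free-walk-with-down p eq d>0 =
    proj₂ (lap-free-walk-into-0 p eq)

  closed-walk-ups≡downs : (p : Walk r x r′ x ℓ) → ups p ≡ downs p
  closed-walk-ups≡downs {x = x} p =
    +-injective (i-j≡0⇒i≡j _ _ (trans (sym (displacement p)) (+-inverseʳ x)))

  closed-walk-ups≤ : (p : Walk r x r x ℓ) → ℓ ≡ n ℕ.* suc m → ups p ≤ m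
  closed-walk-ups≤ {r} {ℓ = ℓ} p ℓ≡ with ups p ℕ.≤? m
  ... | yes ups≤m = ups≤m
  ... | no ups≰m  = ⊥-elim (ℕ.1+n≢0 (trans (sym ups≡1+m) (lap-free-closed-walk p lap-free downs>0)))
    where
    ups≡downs : ups p ≡ downs p
    ups≡downs = closed-walk-ups≡downs p
    ℓ≡laps*n : ℓ ≡ laps p ℕ.* n
    ℓ≡laps*n = ℕ.+-cancelˡ-≡ (downs p) _ _ (begin
      downs p ℕ.+ ℓ                  ≡⟨ ℕ.+-comm (downs p) ℓ ⟩
      ℓ ℕ.+ downs p                  ≡⟨ cong (ℓ ℕ.+_) ups≡downs ⟨
      ℓ ℕ.+ ups p                    ≡⟨ ℕ.+-cancelʳ-≡ r _ _ (residue-balance p) ⟩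
      downs p ℕ.+ laps p ℕ.* n       ∎)
      where open ≡-Reasoning
    laps≡1+m : laps p ≡ suc m
    laps≡1+m = ℕ.*-cancelʳ-≡ (laps p) (suc m) n (trans (sym ℓ≡laps*n) (trans ℓ≡ (ℕ.*-comm n (suc m))))
    ups≡1+m : ups p ≡ suc m
    ups≡1+m = ℕ.≤-antisym (subst (ups p ≤_) laps≡1+m (ups≤laps p)) (ℕ.≰⇒> ups≰m)
    lap-free : ups p ≡ laps p
    lap-free = trans ups≡1+m (sym laps≡1+m)
    downs>0 : 0 < downs p
    downs>0 = subst (0 <_) (trans (sym ups≡1+m) ups≡downs) (s≤s z≤n)

  completable-walk-displacement≤ : (p : Walk r x r′ y ℓ) (q : Walk r′ y r x ℓ′) →
                                   ℓ ℕ.+ ℓ′ ≡ n ℕ.* suc m → ∣ y - x ∣ ≤ m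
  completable-walk-displacement≤ {x = x} {y = y} p q len≡ = begin
    ∣ y - x ∣                      ≡⟨ cong ∣_∣ (trans (displacement p) (m-n≡m⊖n (ups p) (downs p))) ⟩
    ∣ ups p ⊖ downs p ∣            ≤⟨ ∣m⊝n∣≤m⊔n (ups p) (downs p) ⟩
    ups p ℕ.⊔ downs p              ≤⟨ ℕ.⊔-lub ups-p≤m downs-p≤m ⟩
    m                              ∎
    where
    open ℕ.≤-Reasoning
    ups≤m : ups (p ++ q) ≤ m
    ups≤m = closed-walk-ups≤ (p ++ q) len≡
    ups-p≤m : ups p ≤ m
    ups-p≤m = ℕ.≤-trans (ℕ.≤-trans (ℕ.m≤m+n (ups p) (ups q)) (ℕ.≤-reflexive (sym (ups-++ p q)))) ups≤m
    downs-p≤m : downs p ≤ m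
    downs-p≤m = ℕ.≤-trans (ℕ.≤-trans (ℕ.m≤m+n (downs p) (downs q)) (ℕ.≤-reflexive (sym (downs-++ p q))))
                          (subst (_≤ m) (closed-walk-ups≡downs (p ++ q)) ups≤m)

module Letters (m : ℕ) (c : Subword (2 ℕ.+ m)) where

  open Walks m

  h : 2 ≤ n
  h = s≤s (s≤s z≤n)

  L : ℕ
  L = len n

  res : ℤ → ℕ
  res t = t %ℕ n

  letter : ℤ → ℤ → ℤ
  letter = u n h c

  [1+r]%n≢r : ∀ {r} → r < n → suc r % n ≢ r
  [1+r]%n≢r {r} r<n with r ℕ.≟ suc m
  ... | yes refl = λ eq → ℕ.1+n≢0 (trans (sym eq) (n%n≡0 n))
  ... | no r≢1+m = λ eq → ℕ.1+n≢n (trans (sym (m<n⇒m%n≡m 1+r<n)) eq)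
    where
    1+r<n : suc r < n
    1+r<n = s≤s (ℕ.≤∧≢⇒< (ℕ.≤-pred r<n) r≢1+m)

  s-up : ∀ P x → res x ≡ P % n → s n h P x ≡ x + + 1
  s-up P x x≡P rewrite dec-true (res x ℕ.≟ P % n) x≡P = refl

  s-down : ∀ P x → res x ≢ P % n → res x ≡ suc P % n → s n h P x ≡ x - + 1
  s-down P x x≢P x≡1+P
    rewrite dec-false (res x ℕ.≟ P % n) x≢P | dec-true (res x ℕ.≟ suc P % n) x≡1+P = refl

  s-fix : ∀ P x → res x ≢ P % n → res x ≢ suc P % n → s n h P x ≡ x
  s-fix P x x≢P x≢1+P
    rewrite dec-false (res x ℕ.≟ P % n) x≢P | dec-false (res x ℕ.≟ suc P % n) x≢1+P = refl

  s-involutive : ∀ P x → s n h P (s n h P x) ≡ x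
  s-involutive P x with res x ℕ.≟ P % n | res x ℕ.≟ suc P % n
  ... | yes x≡P | _ = begin
    s n h P (s n h P x)        ≡⟨ cong (s n h P) (s-up P x x≡P) ⟩
    s n h P (x + + 1)          ≡⟨ s-down P (x + + 1) x+1≢P x+1≡1+P ⟩
    x + + 1 - + 1              ≡⟨ ℤ.solve (x ∷ []) ⟩
    x                          ∎
    where
    open ≡-Reasoning
    x+1≡1+P : res (x + + 1) ≡ suc P % n
    x+1≡1+P = trans (%ℕ-+-cong x (+ P) (+ 1) x≡P) (cong (_% n) (ℕ.+-comm P 1))
    x+1≢P : res (x + + 1) ≢ P % n
    x+1≢P eq = [1+r]%n≢r (m%n<n P n) (trans (sym (%-distribˡ-+ 1 P n)) (trans (sym x+1≡1+P) eq))
  ... | no x≢P | yes x≡1+P = begin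
    s n h P (s n h P x)        ≡⟨ cong (s n h P) (s-down P x x≢P x≡1+P) ⟩
    s n h P (x - + 1)          ≡⟨ s-up P (x - + 1) (%ℕ-+-cong x (+ suc P) (- + 1) x≡1+P) ⟩
    x - + 1 + + 1              ≡⟨ ℤ.solve (x ∷ []) ⟩
    x                          ∎
    where open ≡-Reasoning
  ... | no x≢P | no x≢1+P = trans (cong (s n h P) fixed) fixed
    where fixed = s-fix P x x≢P x≢1+P

  letter-involutive : ∀ j x → letter j (letter j x) ≡ x
  letter-involutive j x with c (fromℕ< (n%ℕd<d (j - + 1) L))
  ... | true  = s-involutive ((j - + 1) %ℕ L) x
  ... | false = refl

  letter-cong : ∀ {j j′} x → (j - + 1) %ℕ L ≡ (j′ - + 1) %ℕ L → letter j x ≡ letter j′ x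
  letter-cong {j} {j′} x eq
    with c (fromℕ< (n%ℕd<d (j - + 1) L)) | c (fromℕ< (n%ℕd<d (j′ - + 1) L))
       | cong c (fromℕ<-cong _ _ eq (n%ℕd<d (j - + 1) L) (n%ℕd<d (j′ - + 1) L))
  ... | true  | .true  | refl = cong (λ P → s n h P x) eq
  ... | false | .false | refl = refl

  letter-periodic : ∀ j x → letter (j + + L) x ≡ letter j x
  letter-periodic j x = letter-cong x (begin
    (j + + L - + 1) %ℕ L          ≡⟨ cong (_%ℕ L) (regroup j (+ L)) ⟩
    (j - + 1 + + 1 * + L) %ℕ L    ≡⟨ [a+q*n]%ℕn≡a%ℕn (j - + 1) (+ 1) ⟩
    (j - + 1) %ℕ L                ∎)
    where
    open ≡-Reasoning
    regroup : ∀ j N → j + N - + 1 ≡ j - + 1 + + 1 * N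
    regroup = ℤ.solve-∀

  private
    [j-1]%ℕL%n≡res[j-1] : ∀ j → (j - + 1) %ℕ L % n ≡ res (j - + 1)
    [j-1]%ℕL%n≡res[j-1] j = a%ℕ[n*k]%n≡a%ℕn (j - + 1) (suc m)

    [1+[j-1]%ℕL]%n≡res[j] : ∀ j → suc ((j - + 1) %ℕ L) % n ≡ res j
    [1+[j-1]%ℕL]%n≡res[j] j = begin
      suc ((j - + 1) %ℕ L) % n         ≡⟨ cong (_% n) (ℕ.+-comm 1 ((j - + 1) %ℕ L)) ⟩
      res (+ ((j - + 1) %ℕ L) + + 1)   ≡⟨ %ℕ-+-cong (+ ((j - + 1) %ℕ L)) (j - + 1) (+ 1)
                                           ([j-1]%ℕL%n≡res[j-1] j) ⟩
      res (j - + 1 + + 1)              ≡⟨ cong res j-1+1≡j ⟩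
      res j                            ∎
      where
      open ≡-Reasoning
      j-1+1≡j : j - + 1 + + 1 ≡ j
      j-1+1≡j = ℤ.solve (j ∷ [])

  letter-moves : ∀ j x → (letter j x ≡ x + + 1 × res (x - j) ≡ suc m)
                       ⊎ (letter j x ≡ x - + 1 × res (x - j) ≡ 0)
                       ⊎ letter j x ≡ x
  letter-moves j x with c (fromℕ< (n%ℕd<d (j - + 1) L))
  ... | false = inj₂ (inj₂ refl)
  ... | true with res x ℕ.≟ (j - + 1) %ℕ L % n | res x ℕ.≟ suc ((j - + 1) %ℕ L) % n
  ...   | yes x≡P  | _          = inj₁ (s-up ((j - + 1) %ℕ L) x x≡P , at-top)
    where
    j-1-j≡-1 : j - + 1 - j ≡ - + 1
    j-1-j≡-1 = ℤ.solve (j ∷ [])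
    at-top : res (x - j) ≡ suc m
    at-top = trans (%ℕ-+-cong x (j - + 1) (- j) (trans x≡P ([j-1]%ℕL%n≡res[j-1] j))) (cong res j-1-j≡-1)
  ...   | no x≢P   | yes x≡1+P  = inj₂ (inj₁ (s-down ((j - + 1) %ℕ L) x x≢P x≡1+P , at-bottom))
    where
    at-bottom : res (x - j) ≡ 0
    at-bottom = trans (%ℕ-+-cong x j (- j) (trans x≡1+P ([1+[j-1]%ℕL]%n≡res[j] j))) (cong res (+-inverseʳ j))
  ...   | no x≢P   | no x≢1+P   = inj₂ (inj₂ (s-fix ((j - + 1) %ℕ L) x x≢P x≢1+P))

  res[t+1]≡0 : ∀ t → res t ≡ suc m → res (t + + 1) ≡ 0
  res[t+1]≡0 t top = trans ([a+1]%ℕn≡[1+a%ℕn]%n t) (trans (cong (λ r → suc r % n) top) (n%n≡0 n))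

  res[t+1]≡1+res[t] : ∀ t → res t ≢ suc m → res (t + + 1) ≡ suc (res t)
  res[t+1]≡1+res[t] t ¬top =
    trans ([a+1]%ℕn≡[1+a%ℕn]%n t) (m<n⇒m%n≡m (s≤s (ℕ.≤∧≢⇒< (ℕ.≤-pred (n%ℕd<d t n)) ¬top)))

  rise : ∀ t {t′} x → res t ≡ suc m → t′ ≡ t + + 1 + + 1 → Walk (res t) x (res t′) (x + + 1) 1
  rise t x top refl rewrite res[t+1]≡1+res[t] (t + + 1) (λ eq → ℕ.1+n≢0 (trans (sym eq) (res[t+1]≡0 t top)))
                            | res[t+1]≡0 t top | top = up []

  fall : ∀ t {t′} x → res t ≡ 0 → t′ ≡ t → Walk (res t) x (res t′) (x - + 1) 1
  fall t x bottom refl rewrite bottom = down []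

  stay : ∀ t {t′} x → t′ ≡ t + + 1 → Walk (res t) x (res t′) x 1
  stay t x refl with res t ℕ.≟ suc m
  ... | yes top  rewrite res[t+1]≡0 t top | top = wrap []
  ... | no ¬top rewrite res[t+1]≡1+res[t] t ¬top = tick ¬top []

  private
    rise-end : ∀ x j → x - (j + + 1) + + 1 + + 1 ≡ x + + 1 - j
    rise-end = ℤ.solve-∀
    fall-end : ∀ x j → x - (j + + 1) ≡ x - + 1 - j
    fall-end = ℤ.solve-∀
    stay-end : ∀ x j → x - (j + + 1) + + 1 ≡ x - j
    stay-end = ℤ.solve-∀

  step : ∀ {j j′} x → j ≡ j′ + + 1 → Walk (res (x - j)) x (res (letter j x - j′)) (letter j x) 1
  step {j′ = j′} x refl with letter-moves (j′ + + 1) x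
  ... | inj₁ (moved , top)           rewrite moved = rise (x - (j′ + + 1)) x top (sym (rise-end x j′))
  ... | inj₂ (inj₁ (moved , bottom)) rewrite moved = fall (x - (j′ + + 1)) x bottom (sym (fall-end x j′))
  ... | inj₂ (inj₂ fixed)            rewrite fixed = stay (x - (j′ + + 1)) x (sym (stay-end x j′))

  product : ℤ → ℕ → ℤ → ℤ
  product = uProd n h c

  trajectory : ∀ {a j j′} d x → j ≡ a + + d → a ≡ j′ + + 1 →
               Walk (res (x - j)) x (res (product a d x - j′)) (product a d x) (suc d)
  trajectory {a} zero    x j≡ a≡ rewrite j≡ | +-identityʳ a = step x a≡
  trajectory {a} (suc d) x refl a≡ =
    step x (a+[1+d]≡a+d+1 a (+ d)) ++ trajectory d (letter (a + + suc d) x) refl a≡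
    where
    a+[1+d]≡a+d+1 : ∀ a d → a + (+ 1 + d) ≡ a + d + + 1
    a+[1+d]≡a+d+1 = ℤ.solve-∀

  product-peel : ∀ a d k → product a (suc d) k ≡ letter a (product (a + + 1) d k)
  product-peel a zero    k = refl
  product-peel a (suc d) k = trans (product-peel a d _)
    (cong (λ j → letter a (product (a + + 1) d (letter j k)))
          (sym (+-assoc a (+ 1) (+ suc d))))

  product-split : ∀ a e d k → product a (e ℕ.+ suc d) k ≡ product a e (product (a + + suc e) d k)
  product-split a e zero    k = cong (λ i → product a i k) (ℕ.+-comm e 1)
  product-split a e (suc d) k rewrite ℕ.+-suc e (suc d) = trans (product-split a e d _)
    (cong (λ j → product a e (product (a + + suc e) d (letter j k)))
          (sym (+-assoc a (+ suc e) (+ suc d))))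

  L≡2+[L∸2] : L ≡ 2 ℕ.+ (L ∸ 2)
  L≡2+[L∸2] = sym (ℕ.m+[n∸m]≡n (ℕ.*-mono-≤ {2} {n} {1} {suc m} h (s≤s z≤n)))

  product-rotate : ∀ a k → letter a (product (a + + 1) (suc (L ∸ 2)) k)
                         ≡ product a (suc (L ∸ 2)) (letter a k)
  product-rotate a k = trans (cong (λ y → letter a (product (a + + 1) (L ∸ 2) y)) top-letter)
                             (sym (product-peel a (L ∸ 2) (letter a k)))
    where
    top-letter : letter (a + + 1 + + suc (L ∸ 2)) k ≡ letter a k
    top-letter = trans (cong (λ j → letter j k) (trans (+-assoc a (+ 1) (+ suc (L ∸ 2)))
                                                        (cong (λ i → a + + i) (sym L≡2+[L∸2]))))
                       (letter-periodic a k)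

  -- uProd a d has d + 1 factors, so this says u_a ⋯ u_{a+L−1} = e.
  IsIdentityAt : ℤ → Set
  IsIdentityAt a = ∀ k → product a (suc (L ∸ 2)) k ≡ k

  identity-suc : ∀ {a} → IsIdentityAt a → IsIdentityAt (a + + 1)
  identity-suc {a} isId k = begin
    product (a + + 1) (suc (L ∸ 2)) k                          ≡⟨ letter-involutive a _ ⟨
    letter a (letter a (product (a + + 1) (suc (L ∸ 2)) k))    ≡⟨ cong (letter a) (product-rotate a k) ⟩
    letter a (product a (suc (L ∸ 2)) (letter a k))            ≡⟨ cong (letter a) (isId (letter a k)) ⟩
    letter a (letter a k)                                      ≡⟨ letter-involutive a k ⟩
    k                                                          ∎
    where open ≡-Reasoning

  identity-pred : ∀ {a} → IsIdentityAt (a + + 1) → IsIdentityAt a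
  identity-pred {a} isId k = begin
    product a (suc (L ∸ 2)) k
      ≡⟨ cong (product a (suc (L ∸ 2))) (letter-involutive a k) ⟨
    product a (suc (L ∸ 2)) (letter a (letter a k))            ≡⟨ product-rotate a (letter a k) ⟨
    letter a (product (a + + 1) (suc (L ∸ 2)) (letter a k))    ≡⟨ cong (letter a) (isId (letter a k)) ⟩
    letter a (letter a k)                                      ≡⟨ letter-involutive a k ⟩
    k                                                          ∎
    where open ≡-Reasoning

  private
    a+i+1≡a+[1+i] : ∀ a i → a + + i + + 1 ≡ a + + suc i
    a+i+1≡a+[1+i] a i = trans (+-assoc a (+ i) (+ 1)) (cong (λ t → a + t) (+-comm (+ i) (+ 1)))

  identity-+ : ∀ {a} i → IsIdentityAt a → IsIdentityAt (a + + i)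
  identity-+ {a} zero    isId = subst IsIdentityAt (sym (+-identityʳ a)) isId
  identity-+ {a} (suc i) isId = subst IsIdentityAt (a+i+1≡a+[1+i] a i) (identity-suc (identity-+ i isId))

  identity-∸ : ∀ {a} i → IsIdentityAt (a + + i) → IsIdentityAt a
  identity-∸ {a} zero    isId = subst IsIdentityAt (+-identityʳ a) isId
  identity-∸ {a} (suc i) isId = identity-∸ i (identity-pred (subst IsIdentityAt (sym (a+i+1≡a+[1+i] a i)) isId))

  identity-everywhere : IsIdentityAt (+ 1) → ∀ a → IsIdentityAt a
  identity-everywhere isId a = subst IsIdentityAt (1+[a-1]≡a a) (identity-from-1 (a - + 1))
    where
    1+[a-1]≡a : ∀ a → + 1 + (a - + 1) ≡ a
    1+[a-1]≡a = ℤ.solve-∀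
    b-[1+i]+[1+i]≡b : ∀ b i → b + - (+ 1 + i) + (+ 1 + i) ≡ b
    b-[1+i]+[1+i]≡b = ℤ.solve-∀
    identity-from-1 : ∀ i → IsIdentityAt (+ 1 + i)
    identity-from-1 (+ i)    = identity-+ i isId
    identity-from-1 -[1+ i ] = identity-∸ (suc i) (subst IsIdentityAt (sym (b-[1+i]+[1+i]≡b (+ 1) (+ i))) isId)

  private
    b≡b-1+1 : ∀ b → b ≡ b - + 1 + + 1
    b≡b-1+1 = ℤ.solve-∀

  res-+L : ∀ t → res (t + + L) ≡ res t
  res-+L t = trans (cong (λ i → res (t + + i)) (ℕ.*-comm n (suc m))) ([a+q*n]%ℕn≡a%ℕn t (+ suc m))

  -- For d + e = L − 2 the e + 1 letters below u_a complete u_a ⋯ u_{a+d} to L consecutive letters.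
  module Complement (trivial : ∀ a → IsIdentityAt a) (a : ℤ) (d e : ℕ) (d+e≡ : d ℕ.+ e ≡ L ∸ 2) where

    start : ℤ
    start = a - + suc e

    returns : ∀ k → product start e (product a d k) ≡ k
    returns k = begin
      product start e (product a d k)
        ≡⟨ cong (λ b → product start e (product b d k)) (sym start+[1+e]≡a) ⟩
      product start e (product (start + + suc e) d k)   ≡⟨ product-split start e d k ⟨
      product start (e ℕ.+ suc d) k                     ≡⟨ cong (λ i → product start i k) e+[1+d]≡ ⟩
      product start (suc (L ∸ 2)) k                     ≡⟨ trivial start k ⟩
      k                                                 ∎
      where
      open ≡-Reasoning
      a-b+b≡a : ∀ a b → a - b + b ≡ a
      a-b+b≡a = ℤ.solve-∀
      start+[1+e]≡a : start + + suc e ≡ a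
      start+[1+e]≡a = a-b+b≡a a (+ suc e)
      e+[1+d]≡ : e ℕ.+ suc d ≡ suc (L ∸ 2)
      e+[1+d]≡ = trans (ℕ.+-suc e d) (cong suc (trans (ℕ.+-comm e d) d+e≡))

    walk : ∀ k → Walk (res (product a d k - (a - + 1))) (product a d k) (res (k - (a + + d))) k (suc e)
    walk k = subst (λ r → Walk _ y r k (suc e)) end-residue
               (subst (λ z → Walk _ y (res (z - (start - + 1))) z (suc e)) (returns k)
                      (trajectory e y (a-1≡a-[1+e]+e a (+ e)) (b≡b-1+1 start)))
      where
      y = product a d k
      a-1≡a-[1+e]+e : ∀ a e → a - + 1 ≡ a - (+ 1 + e) + e
      a-1≡a-[1+e]+e = ℤ.solve-∀
      regroup : ∀ k a d e → k - (a - (+ 1 + e) - + 1) ≡ k - (a + d) + (+ 1 + (+ 1 + (d + e)))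
      regroup = ℤ.solve-∀
      end-residue : res (k - (start - + 1)) ≡ res (k - (a + + d))
      end-residue = begin
        res (k - (start - + 1))                         ≡⟨ cong res (regroup k a (+ d) (+ e)) ⟩
        res (k - (a + + d) + + (2 ℕ.+ (d ℕ.+ e)))      ≡⟨ cong (λ i → res (k - (a + + d) + + i)) 2+[d+e]≡L ⟩
        res (k - (a + + d) + + L)                       ≡⟨ res-+L (k - (a + + d)) ⟩
        res (k - (a + + d))                             ∎
        where
        open ≡-Reasoning
        2+[d+e]≡L : 2 ℕ.+ (d ℕ.+ e) ≡ L
        2+[d+e]≡L = trans (cong (2 ℕ.+_) d+e≡) (sym L≡2+[L∸2])

  e-subword-trivial : IsESubword n h c → ∀ a → IsIdentityAt a
  e-subword-trivial esw = identity-everywhere λ k →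
    subst (λ i → product (+ 1) i k ≡ k) (cong (_∸ 1) L≡2+[L∸2]) (esw k)

  displacement-bound : (∀ a → IsIdentityAt a) → ∀ k a d → d < L → ∣ product a d k - k ∣ ≤ m
  displacement-bound trivial k a d d<L with ℕ.m≤n⇒m<n∨m≡n (ℕ.≤-pred (subst (d <_) L≡2+[L∸2] d<L))
  ... | inj₂ refl = begin
    ∣ product a d k - k ∣     ≡⟨ cong (λ t → ∣ t - k ∣) (trivial a k) ⟩
    ∣ k - k ∣                 ≡⟨ cong ∣_∣ (+-inverseʳ k) ⟩
    0                         ≤⟨ z≤n ⟩
    m                         ∎
    where open ℕ.≤-Reasoning
  ... | inj₁ d<1+[L∸2] with e , d+e≡ ← ℕ.m≤n⇒∃[o]m+o≡n (ℕ.≤-pred d<1+[L∸2]) =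
    completable-walk-displacement≤ (trajectory d k refl (b≡b-1+1 a)) (Complement.walk trivial a d e d+e≡ k)
      (trans (cong suc (ℕ.+-suc d e)) (trans (cong (2 ℕ.+_) d+e≡) (sym L≡2+[L∸2])))

lemma5p12 : (n : ℕ) → (h : 2 ≤ n) → (c : Subword n) → IsESubword n h c →
    (k a : ℤ) → (d : ℕ) → d < len n →
    ∣ uProd n h c a d k - k ∣ ≤ n ∸ 2
lemma5p12 (suc (suc m)) (s≤s (s≤s z≤n)) c esw = displacement-bound (e-subword-trivial esw)
  where open Letters m c
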